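{- Let $G=(V,E)$ be a loopless strongly connected graph with bank vertex $\$\in V$, and let $U:=\{\mathbf{u}\in\mathbf{Z}^{V}:\ \mathbf{1}^{\dagger}\mathbf{u}=0\}$. Then $K(G)$ is the subgroup $U/Q^{\dagger}\mathbf{Z}^{V}$ of $\mathcal{K}(G)$, and the map $\mathbf{u}+Q^{\dagger}\mathbf{Z}^{V}\mapsto[\mathbf{u}]$ is a well-defined bijection from $K(G)$ onto the set of coevalence classes of critical configurations on $(G,\$)$.
   Context: A graph is a finite directed multigraph. For $G=(V,E)$, $A$ is the $V\times V$ matrix with $A_{vw}$ the number of directed edges from $v$ to $w$, $\Delta$ is diagonal with $\Delta_{vv}=\sum_wA_{vw}$ (outdegree), $Q=\Delta-A$, $\dagger$ denotes transpose, $\mathcal{K}(G)=\mathbf{Z}^V/Q^{\dagger}\mathbf{Z}^V$, and $K(G)$ is its torsion subgroup. $\hat v$ is the characteristic vector of $v$, $\mathbf{1}$ the all-ones vector. A configuration is $\mathbf{c}\in\mathbf{Z}^V$ with $\mathbf{1}^{\dagger}\mathbf{c}=0$. A vertex $v\neq\$$ is legal for $\mathbf{c}$ if $c(v)\ge\Delta_{vv}$; $\mathbf{c}$ is stable if $c(v)<\Delta_{vv}$ for all $v\ne\$$, and $\$$ is legal for $\mathbf{c}$ exactly when $\mathbf{c}$ is stable. Firing $v$ gives $\mathbf{c}|v:=\mathbf{c}-Q^{\dagger}\hat v$; a sequence $v_1\cdots v_k$ is legal for $\mathbf{c}$ if each $v_i$ is legal for $\mathbf{c}|v_1\cdots v_{i-1}$.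 $\mathcal{S}(\mathbf{c})$ is the set of configurations $\mathbf{c}|v_1\cdots v_k$ for legal sequences (possibly empty) not containing $\$$; it is known that $\mathcal{S}(\mathbf{c})$ contains a unique stable configuration, the stabilization $\overline{\mathbf{c}}$ of $\mathbf{c}$. For stable $\mathbf{c}$, the successor $\sigma(\mathbf{c})$ is the stabilization of $\mathbf{c}|\$$. A stable $\mathbf{c}$ is critical if $\sigma^k(\mathbf{c})=\mathbf{c}$ for some $k\ge1$. Critical $\mathbf{a},\mathbf{b}$ are coeval if $\sigma^m(\mathbf{a})=\mathbf{b}$ for some $m\ge0$; this is an equivalence relation on critical configurations. For any configuration $\mathbf{c}$, there is $m_0\ge0$ such that $\sigma^m(\overline{\mathbf{c}})$ is critical for all $m\ge m_0$, and these are all coeval; their coevalence class is denoted $[\mathbf{c}]$. -}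

module Defs where

open import Data.Nat as ℕ using (ℕ; zero; suc; _>_)
open import Data.Integer as ℤ using (ℤ; +_; _-_; _*_; _≤_)
open import Data.Fin using (Fin; zero; suc)
open import Data.Vec using (Vec; []; _∷_; lookup; tabulate; foldr)
open import Data.Product using (Σ; _×_; ∃)
open import Relation.Binary.PropositionalEquality using (_≡_; _≢_)
open import Relation.Nullary using (Dec; yes; no)
open import Data.Fin using (_≟_)

-- A directed multigraph on vertex set Fin n, given by its adjacency matrix:
-- A v w = number of directed edges from v to w.
Adj : ℕ → Set
Adj n = Fin n → Fin n → ℕ

ZV : ℕ → Set
ZV n = Vec ℤ n

sumℤ : ∀ {n} → ZV n → ℤ
sumℤ = foldr _ ℤ._+_ (+ 0)

sumℕ : ∀ {n} → (Fin n → ℕ) → ℕ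
sumℕ {zero}  f = 0
sumℕ {suc n} f = f zero ℕ.+ sumℕ (λ i → f (suc i))

outdeg : ∀ {n} → Adj n → Fin n → ℕ
outdeg A v = sumℕ (A v)

-- Q = Δ - A, entrywise as integers
Qm : ∀ {n} → Adj n → Fin n → Fin n → ℤ
Qm A v w with v ≟ w
... | yes _ = + outdeg A v - + A v w
... | no  _ = ℤ.- (+ A v w)

QT : ∀ {n} → Adj n → ZV n → ZV n
QT {n} A z = tabulate λ w → sumℤ (tabulate λ v → Qm A v w * lookup z v)

hat : ∀ {n} → Fin n → ZV n
hat v = tabulate λ w → if? w
  where
  if? : _ → ℤ
  if? w with v ≟ w
  ... | yes _ = + 1
  ... | no  _ = + 0

InImageQT : ∀ {n} → Adj n → ZV n → Set
InImageQT {n} A u = Σ (ZV n) λ z → u ≡ QT A z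

Loopless : ∀ {n} → Adj n → Set
Loopless A = ∀ v → A v v ≡ 0

data Reach {n} (A : Adj n) : Fin n → Fin n → Set where
  here : ∀ {v} → Reach A v v
  step : ∀ {u v w} → A u v > 0 → Reach A v w → Reach A u w

StronglyConnected : ∀ {n} → Adj n → Set
StronglyConnected A = ∀ v w → Reach A v w

IsConfig : ∀ {n} → ZV n → Set
IsConfig c = sumℤ c ≡ + 0

fire : ∀ {n} → Adj n → ZV n → Fin n → ZV n
fire A c v = Data.Vec.zipWith _-_ c (QT A (hat v))

LegalNonBank : ∀ {n} → Adj n → Fin n → ZV n → Fin n → Set
LegalNonBank A b c v = (v ≢ b) × (+ outdeg A v ≤ lookup c v)

Stable : ∀ {n} → Adj n → Fin n → ZV n → Set
Stable A b c = ∀ v → v ≢ b → ℤ.suc (lookup c v) ≤ + outdeg A v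

data FireSeq {n} (A : Adj n) (b : Fin n) : ZV n → ZV n → Set where
  done : ∀ {c} → FireSeq A b c c
  step : ∀ {c d} v → LegalNonBank A b c v → FireSeq A b (fire A c v) d → FireSeq A b c d

Stabilizes : ∀ {n} → Adj n → Fin n → ZV n → ZV n → Set
Stabilizes A b c d = FireSeq A b c d × Stable A b d

-- d = σ(c) (c stable; bank legal exactly when c stable)
Succ : ∀ {n} → Adj n → Fin n → ZV n → ZV n → Set
Succ A b c d = Stable A b c × Stabilizes A b (fire A c b) d

data SuccIter {n} (A : Adj n) (b : Fin n) : ℕ → ZV n → ZV n → Set where
  zero : ∀ {c} → SuccIter A b 0 c c
  suc  : ∀ {m c d e} → Succ A b c d → SuccIter A b m d e → SuccIter A b (suc m) c e

Critical : ∀ {n} → Adj n → Fin n → ZV n → Set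
Critical A b c = IsConfig c × Stable A b c × Σ ℕ λ k → k > 0 × SuccIter A b k c c

Coeval : ∀ {n} → Adj n → Fin n → ZV n → ZV n → Set
Coeval A b a c = Σ ℕ λ m → SuccIter A b m a c

-- c ∈ [u] : c is critical and c = σ^m(ū) for some m
-- (equivalent to: c is coeval with the eventual critical σ^m(ū))
InClassOf : ∀ {n} → Adj n → Fin n → ZV n → ZV n → Set
InClassOf A b u c = Critical A b c × Σ _ λ d → Stabilizes A b u d × Coeval A b d c

InCoevalClass : ∀ {n} → Adj n → Fin n → ZV n → ZV n → Set
InCoevalClass A b c c' = Critical A b c' × Coeval A b c c'

IsTorsion : ∀ {n} → Adj n → ZV n → Set
IsTorsion A u = Σ ℕ λ k → k > 0 × InImageQT A (Data.Vec.map (λ x → + k * x) u)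

-- A legal run from c to d gives d = c - Q†x, where x ≥ 0 is its firing vector. Stabilization
-- terminates because Σ_w φ_w c_w, with weights growing geometrically away from the bank, drops
-- at every non-bank firing. A critical c returns to itself along a run which, by strong
-- connectivity, fires every vertex; its firing vector f is a positive element of ker Q†, and
-- c ≥ 0 off the bank. The least action principle (for y ≥ 0 with c - Q†y stable, a legal run
-- from c firing the bank at most y_$ times fires at most y) then shows that a stable s with
-- s - c ∈ Q†Z^V reaches c under σ: replace the difference by a preimage y ≥ 0 (adding a multiple
-- of f), apply σ y_$ times, and compare the result with repetitions of the loop of c. Hence
-- u + Q†Z^V ↦ [u] is well defined and injective, and each critical class is [c]. Configurations
-- are torsion because the critical representatives of u, 2u, 3u, … lie in a finite box, so two
-- coincide; conversely 1†Q† = 0 forces a torsion class to have sum 0.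
module Submission where

open import Defs
open import Data.Nat using (ℕ)
open import Data.Fin using (Fin)
open import Data.Product using (Σ; _×_)
open import Data.Vec using (zipWith)
open import Data.Integer using (_-_)
open import Function.Bundles using (_⇔_)

open import Data.Nat as ℕ using (zero; suc; z≤n; s≤s)
import Data.Nat.Properties as ℕP
open import Data.Integer as ℤ using (ℤ; +_; -_; _+_; _*_; _≤_; _<_)
import Data.Integer.Properties as ℤP
open import Data.Integer.Tactic.RingSolver using (solve-∀)
open import Data.Fin as F using (zero; suc; _≟_; toℕ)
import Data.Fin.Properties as FP
open import Data.Vec as V using (Vec; []; _∷_; lookup; tabulate)
import Data.Vec.Properties as VP
open import Data.Empty using (⊥-elim)
open import Data.Product using (_,_; proj₁; proj₂; ∃₂)
open import Data.Sum using (_⊎_; inj₁; inj₂)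
open import Function.Base using (_∘_; _∋_)
open import Function.Bundles using (mk⇔; Equivalence)
open import Relation.Binary.PropositionalEquality
open import Relation.Nullary using (Dec; yes; no; _×-dec_)
open import Algebra.Properties.Semiring.Sum ℤP.+-*-semiring
  using (sum; ∑-distrib-+; ∑-comm; *-distribˡ-sum; sum-cong-≗; sum-replicate-zero; sum-remove)

*-nonNeg : ∀ {x y : ℤ} → + 0 ≤ x → + 0 ≤ y → + 0 ≤ x * y
*-nonNeg {x} 0≤x 0≤y =
  ℤP.≤-trans (ℤP.≤-reflexive (sym (ℤP.*-zeroʳ x))) (ℤP.*-monoˡ-≤-nonNeg x {{ℤ.nonNegative 0≤x}} 0≤y)

*-pos : ∀ {x y : ℤ} → + 0 < x → + 0 < y → + 0 < x * y
*-pos {x} 0<x 0<y =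
  ℤP.≤-<-trans (ℤP.≤-reflexive (sym (ℤP.*-zeroʳ x))) (ℤP.*-monoˡ-<-pos x {{ℤ.positive 0<x}} 0<y)

sum-zero : ∀ {n} → sum {n} (λ _ → + 0) ≡ + 0
sum-zero {n} = sum-replicate-zero n

sum-neg : ∀ {n} (f : Fin n → ℤ) → sum (λ i → - f i) ≡ - sum f
sum-neg {zero}  f = refl
sum-neg {suc n} f = trans (cong (_+_ (- f zero)) (sum-neg (f ∘ suc))) (sym (ℤP.neg-distrib-+ (f zero) _))

sum-distrib-- : ∀ {n} (f g : Fin n → ℤ) → sum (λ i → f i - g i) ≡ sum f - sum g
sum-distrib-- f g = trans (∑-distrib-+ f (λ i → - g i)) (cong (_+_ (sum f)) (sum-neg g))

sum-mono-≤ : ∀ {n} {f g : Fin n → ℤ} → (∀ i → f i ≤ g i) → sum f ≤ sum g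
sum-mono-≤ {zero}  f≤g = ℤP.≤-refl
sum-mono-≤ {suc n} f≤g = ℤP.+-mono-≤ (f≤g zero) (sum-mono-≤ (f≤g ∘ suc))

sum-nonNeg : ∀ {n} {f : Fin n → ℤ} → (∀ i → + 0 ≤ f i) → + 0 ≤ sum f
sum-nonNeg {n} 0≤f = ℤP.≤-trans (ℤP.≤-reflexive (sym (sum-zero {n}))) (sum-mono-≤ 0≤f)

term≤sum : ∀ {n} {f : Fin n → ℤ} → (∀ i → + 0 ≤ f i) → ∀ j → f j ≤ sum f
term≤sum {suc n} {f} 0≤f j = begin
  f j                             ≡⟨ ℤP.+-identityʳ (f j) ⟨
  f j + + 0                       ≤⟨ ℤP.+-monoʳ-≤ (f j) (sum-nonNeg (0≤f ∘ F.punchIn j)) ⟩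
  f j + sum (f ∘ F.punchIn j)     ≡⟨ sum-remove f ⟨
  sum f                           ∎
  where open ℤP.≤-Reasoning

-∣i∣≤i : ∀ i → - + ℤ.∣ i ∣ ≤ i
-∣i∣≤i (+ k)      = ℤP.neg-≤-pos
-∣i∣≤i ℤ.-[1+ k ] = ℤP.≤-refl

ℓ¹ : ∀ {n} → (Fin n → ℤ) → ℤ
ℓ¹ x = sum (λ w → + ℤ.∣ x w ∣)

ℓ¹-nonNeg : ∀ {n} (x : Fin n → ℤ) → + 0 ≤ ℓ¹ x
ℓ¹-nonNeg x = sum-nonNeg {f = λ w → + ℤ.∣ x w ∣} (λ _ → ℤ.+≤+ z≤n)

∣x∣≤ℓ¹ : ∀ {n} (x : Fin n → ℤ) v → + ℤ.∣ x v ∣ ≤ ℓ¹ x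
∣x∣≤ℓ¹ x v = term≤sum {f = λ w → + ℤ.∣ x w ∣} (λ _ → ℤ.+≤+ z≤n) v

-ℓ¹≤ : ∀ {n} (x : Fin n → ℤ) v → - ℓ¹ x ≤ x v
-ℓ¹≤ x v = ℤP.≤-trans (ℤP.neg-mono-≤ (∣x∣≤ℓ¹ x v)) (-∣i∣≤i (x v))

-x≤ℓ¹ : ∀ {n} (x : Fin n → ℤ) v → - x v ≤ ℓ¹ x
-x≤ℓ¹ x v = subst (- x v ≤_) (ℤP.neg-involutive (ℓ¹ x)) (ℤP.neg-mono-≤ (-ℓ¹≤ x v))

nonNeg≤ℓ¹ : ∀ {n} (x : Fin n → ℤ) v → + 0 ≤ x v → x v ≤ ℓ¹ x
nonNeg≤ℓ¹ x v 0≤xv = subst (_≤ ℓ¹ x) (ℤP.0≤i⇒+∣i∣≡i 0≤xv) (∣x∣≤ℓ¹ x v)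

i≤i*j : ∀ {i j} → + 0 ≤ i → + 0 < j → i ≤ i * j
i≤i*j {i} {j} 0≤i 0<j =
  subst (_≤ i * j) (ℤP.*-identityʳ i) (ℤP.*-monoˡ-≤-nonNeg i {{ℤ.nonNegative 0≤i}} (ℤP.i<j⇒suc[i]≤j 0<j))

i≤-j+i⇒j≤0 : ∀ {i j} → i ≤ - j + i → j ≤ + 0
i≤-j+i⇒j≤0 {i} {j} i≤-j+i = subst (_≤ + 0) (ℤP.neg-involutive j)
  (ℤP.neg-mono-≤ (subst (+ 0 ≤_) (cancel i j) (ℤP.i≤j⇒0≤j-i i≤-j+i)))
  where
  cancel : ∀ i j → - j + i - i ≡ - j
  cancel = solve-∀

1+i≤j⇒1≤j-i : ∀ {i j} → + 1 + i ≤ j → + 1 ≤ j - i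
1+i≤j⇒1≤j-i {i} {j} 1+i≤j = subst (_≤ j - i) (cancel i) (ℤP.+-monoˡ-≤ (- i) 1+i≤j)
  where
  cancel : ∀ i → + 1 + i - i ≡ + 1
  cancel = solve-∀

δ : ∀ {n} → Fin n → Fin n → ℤ
δ v w with v ≟ w
... | yes _ = + 1
... | no  _ = + 0

δ-refl : ∀ {n} (v : Fin n) → δ v v ≡ + 1
δ-refl v with v ≟ v
... | yes _  = refl
... | no v≢v = ⊥-elim (v≢v refl)

δ-≢ : ∀ {n} {v w : Fin n} → v ≢ w → δ v w ≡ + 0
δ-≢ {v = v} {w} v≢w with v ≟ w
... | yes v≡w = ⊥-elim (v≢w v≡w)
... | no  _   = refl

δ-sym : ∀ {n} (v w : Fin n) → δ v w ≡ δ w v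
δ-sym v w with v ≟ w
... | yes refl = sym (δ-refl v)
... | no  v≢w  = sym (δ-≢ (v≢w ∘ sym))

δ-nonNeg : ∀ {n} (v w : Fin n) → + 0 ≤ δ v w
δ-nonNeg v w with v ≟ w
... | yes _ = ℤ.+≤+ z≤n
... | no  _ = ℤP.≤-refl

sum-δ : ∀ {n} (v : Fin n) (g : Fin n → ℤ) → sum (λ u → δ v u * g u) ≡ g v
sum-δ {suc n} v g = begin
  sum (λ u → δ v u * g u)                                  ≡⟨ sum-remove (λ u → δ v u * g u) ⟩
  δ v v * g v + sum (λ i → δ v (F.punchIn v i) * g (F.punchIn v i))
    ≡⟨ cong₂ _+_ (trans (cong (_* g v) (δ-refl v)) (ℤP.*-identityˡ (g v)))
                 (trans (sum-cong-≗ off-diagonal) (sum-zero {n})) ⟩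
  g v + + 0                                                ≡⟨ ℤP.+-identityʳ (g v) ⟩
  g v                                                      ∎
  where
  open ≡-Reasoning
  off-diagonal : ∀ i → δ v (F.punchIn v i) * g (F.punchIn v i) ≡ + 0
  off-diagonal i =
    trans (cong (_* g (F.punchIn v i)) (δ-≢ (FP.punchInᵢ≢i v i ∘ sym))) (ℤP.*-zeroˡ (g (F.punchIn v i)))

sum-δˡ : ∀ {n} (v : Fin n) (g : Fin n → ℤ) → sum (λ u → δ u v * g u) ≡ g v
sum-δˡ {n} v g = trans (sum-cong-≗ {n} (λ u → cong (_* g u) (δ-sym u v))) (sum-δ v g)

sumℤ≡sum : ∀ {n} (c : Vec ℤ n) → sumℤ c ≡ sum (lookup c)
sumℤ≡sum []      = refl
sumℤ≡sum (x ∷ c) = cong (_+_ x) (sumℤ≡sum c)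

sumℤ-tabulate : ∀ {n} (f : Fin n → ℤ) → sumℤ (tabulate f) ≡ sum f
sumℤ-tabulate {zero}  f = refl
sumℤ-tabulate {suc n} f = cong (_+_ (f zero)) (sumℤ-tabulate (f ∘ suc))

+sumℕ≡sum : ∀ {n} (f : Fin n → ℕ) → + sumℕ f ≡ sum (λ i → + f i)
+sumℕ≡sum {zero}  f = refl
+sumℕ≡sum {suc n} f = trans (ℤP.pos-+ (f zero) _) (cong (_+_ (+ f zero)) (+sumℕ≡sum (f ∘ suc)))

term≤sumℕ : ∀ {n} (f : Fin n → ℕ) v → f v ℕ.≤ sumℕ f
term≤sumℕ f zero    = ℕP.m≤m+n (f zero) _
term≤sumℕ f (suc v) = ℕP.≤-trans (term≤sumℕ (f ∘ suc) v) (ℕP.m≤n+m _ (f zero))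

-- Abstracting over v ≟ w also abstracts it inside the local helper of hat, so both sides reduce.
lookup-hat : ∀ {n} (v : Fin n) → ∀ w → lookup (hat v) w ≡ δ v w
lookup-hat v w with v ≟ w | (lookup (hat v) w ≡ _ ∋ VP.lookup∘tabulate _ w)
... | yes _ | eq = eq
... | no  _ | eq = eq

vec-ext : ∀ {n} {c d : Vec ℤ n} → (∀ i → lookup c i ≡ lookup d i) → c ≡ d
vec-ext {c = c} {d} c≗d =
  trans (sym (VP.tabulate∘lookup c)) (trans (VP.tabulate-cong c≗d) (VP.tabulate∘lookup d))

least-witness : ∀ {p} {P : ℕ → Set p} → (∀ k → Dec (P k)) → ∀ K → P K →
  Σ ℕ λ k → P k × (∀ j → P j → k ℕ.≤ j)
least-witness P? zero    pK = 0 , pK , λ _ _ → z≤n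
least-witness P? (suc K) pK with P? 0
... | yes p0 = 0 , p0 , λ _ _ → z≤n
... | no ¬p0 with least-witness (P? ∘ suc) K pK
...   | k , pk , minimal = suc k , pk , λ { zero p0 → ⊥-elim (¬p0 p0) ; (suc j) pj → s≤s (minimal j pj) }

module Laplacian {n : ℕ} (A : Adj n) where

  deg : Fin n → ℤ
  deg v = + outdeg A v

  a : Fin n → Fin n → ℤ
  a u w = + A u w

  a-nonNeg : ∀ u w → + 0 ≤ a u w
  a-nonNeg u w = ℤ.+≤+ z≤n

  deg≡sum : ∀ v → deg v ≡ sum (a v)
  deg≡sum v = +sumℕ≡sum (A v)

  Qm≡δdeg-a : ∀ u w → Qm A u w ≡ δ u w * deg u - a u w
  Qm≡δdeg-a u w with u ≟ w
  ... | yes _ = cong (_- a u w) (sym (ℤP.*-identityˡ (deg u)))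
  ... | no  _ = sym (ℤP.+-identityˡ _)

  Qm-offDiagonal : ∀ {u w} → u ≢ w → Qm A u w ≡ - a u w
  Qm-offDiagonal {u} {w} u≢w with u ≟ w
  ... | yes u≡w = ⊥-elim (u≢w u≡w)
  ... | no  _   = refl

  Qm-diagonal : ∀ v → Qm A v v ≡ deg v - a v v
  Qm-diagonal v with v ≟ v
  ... | yes _  = refl
  ... | no v≢v = ⊥-elim (v≢v refl)

  Q-rowSum : ∀ v → sum (Qm A v) ≡ + 0
  Q-rowSum v = begin
    sum (Qm A v)                            ≡⟨ sum-cong-≗ (Qm≡δdeg-a v) ⟩
    sum (λ w → δ v w * deg v - a v w)       ≡⟨ sum-distrib-- (λ w → δ v w * deg v) (a v) ⟩
    sum (λ w → δ v w * deg v) - sum (a v)   ≡⟨ cong₂ _-_ (sum-δ v (λ _ → deg v)) (sym (deg≡sum v)) ⟩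
    deg v - deg v                           ≡⟨ ℤP.+-inverseʳ (deg v) ⟩
    + 0                                     ∎
    where open ≡-Reasoning

  totalDeg : ℕ
  totalDeg = sumℕ (outdeg A)

  deg≤totalDeg : ∀ v → deg v ≤ + totalDeg
  deg≤totalDeg v = ℤ.+≤+ (term≤sumℕ (outdeg A) v)

  Q-row-formula : ∀ (x : Fin n → ℤ) v → sum (λ w → Qm A v w * x w) ≡ deg v * x v - sum (λ w → a v w * x w)
  Q-row-formula x v = begin
    sum (λ w → Qm A v w * x w)
      ≡⟨ sum-cong-≗ (λ w → trans (cong (_* x w) (Qm≡δdeg-a v w)) (expand (δ v w) (deg v) (a v w) (x w))) ⟩
    sum (λ w → δ v w * (deg v * x w) - a v w * x w)
      ≡⟨ sum-distrib-- (λ w → δ v w * (deg v * x w)) (λ w → a v w * x w) ⟩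
    sum (λ w → δ v w * (deg v * x w)) - sum (λ w → a v w * x w)
      ≡⟨ cong (_- sum (λ w → a v w * x w)) (sum-δ v (λ w → deg v * x w)) ⟩
    deg v * x v - sum (λ w → a v w * x w) ∎
    where
    open ≡-Reasoning
    expand : ∀ d g e y → (d * g - e) * y ≡ d * (g * y) - e * y
    expand = solve-∀

  Qᵀ : (Fin n → ℤ) → Fin n → ℤ
  Qᵀ x w = sum (λ u → Qm A u w * x u)

  lookup-QT : ∀ z w → lookup (QT A z) w ≡ Qᵀ (lookup z) w
  lookup-QT z w = trans (VP.lookup∘tabulate _ w) (sumℤ-tabulate (λ u → Qm A u w * lookup z u))

  Qᵀ-cong : ∀ {x y} → (∀ u → x u ≡ y u) → ∀ w → Qᵀ x w ≡ Qᵀ y w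
  Qᵀ-cong x≗y w = sum-cong-≗ (λ u → cong (Qm A u w *_) (x≗y u))

  Qᵀ-+ : ∀ x y w → Qᵀ (λ u → x u + y u) w ≡ Qᵀ x w + Qᵀ y w
  Qᵀ-+ x y w = trans (sum-cong-≗ (λ u → ℤP.*-distribˡ-+ (Qm A u w) (x u) (y u)))
                     (∑-distrib-+ (λ u → Qm A u w * x u) (λ u → Qm A u w * y u))

  Qᵀ-neg : ∀ x w → Qᵀ (λ u → - x u) w ≡ - Qᵀ x w
  Qᵀ-neg x w = trans (sum-cong-≗ (λ u → sym (ℤP.neg-distribʳ-* (Qm A u w) (x u))))
                     (sum-neg (λ u → Qm A u w * x u))

  Qᵀ-- : ∀ x y w → Qᵀ (λ u → x u - y u) w ≡ Qᵀ x w - Qᵀ y w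
  Qᵀ-- x y w = trans (Qᵀ-+ x (λ u → - y u) w) (cong (_+_ (Qᵀ x w)) (Qᵀ-neg y w))

  Qᵀ-scale : ∀ k x w → Qᵀ (λ u → k * x u) w ≡ k * Qᵀ x w
  Qᵀ-scale k x w = trans (sum-cong-≗ (λ u → swap (Qm A u w) k (x u)))
                         (sym (*-distribˡ-sum k (λ u → Qm A u w * x u)))
    where
    swap : ∀ q k y → q * (k * y) ≡ k * (q * y)
    swap = solve-∀

  Qᵀ-zero : ∀ w → Qᵀ (λ _ → + 0) w ≡ + 0
  Qᵀ-zero w = trans (sum-cong-≗ (λ u → ℤP.*-zeroʳ (Qm A u w))) (sum-zero {n})

  Qᵀ-δ : ∀ v w → Qᵀ (δ v) w ≡ Qm A v w
  Qᵀ-δ v w = trans (sum-cong-≗ (λ u → ℤP.*-comm (Qm A u w) (δ v u))) (sum-δ v (λ u → Qm A u w))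

  Qᵀ-formula : ∀ x w → Qᵀ x w ≡ deg w * x w - sum (λ u → a u w * x u)
  Qᵀ-formula x w = begin
    Qᵀ x w
      ≡⟨ sum-cong-≗ (λ u → trans (cong (_* x u) (Qm≡δdeg-a u w)) (expand (δ u w) (deg u) (a u w) (x u))) ⟩
    sum (λ u → δ u w * (deg u * x u) - a u w * x u)
      ≡⟨ sum-distrib-- (λ u → δ u w * (deg u * x u)) (λ u → a u w * x u) ⟩
    sum (λ u → δ u w * (deg u * x u)) - sum (λ u → a u w * x u)
      ≡⟨ cong (_- sum (λ u → a u w * x u)) (sum-δˡ w (λ u → deg u * x u)) ⟩
    deg w * x w - sum (λ u → a u w * x u) ∎
    where
    open ≡-Reasoning
    expand : ∀ d g e y → (d * g - e) * y ≡ d * (g * y) - e * y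
    expand = solve-∀

  sum-Qᵀ : ∀ x → sum (Qᵀ x) ≡ + 0
  sum-Qᵀ x = begin
    sum (λ w → sum (λ u → Qm A u w * x u))   ≡⟨ ∑-comm (λ u w → Qm A u w * x u) ⟨
    sum (λ u → sum (λ w → Qm A u w * x u))   ≡⟨ sum-cong-≗ row ⟩
    sum {n} (λ _ → + 0)                      ≡⟨ sum-zero {n} ⟩
    + 0                                      ∎
    where
    open ≡-Reasoning
    row : ∀ u → sum (λ w → Qm A u w * x u) ≡ + 0
    row u = begin
      sum (λ w → Qm A u w * x u)   ≡⟨ sum-cong-≗ (λ w → ℤP.*-comm (Qm A u w) (x u)) ⟩
      sum (λ w → x u * Qm A u w)   ≡⟨ *-distribˡ-sum (x u) (Qm A u) ⟨
      x u * sum (Qm A u)           ≡⟨ cong (x u *_) (Q-rowSum u) ⟩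
      x u * + 0                    ≡⟨ ℤP.*-zeroʳ (x u) ⟩
      + 0                          ∎

  Qᵀ-at-zero : ∀ (x : Fin n → ℤ) w → x w ≡ + 0 → Qᵀ x w ≡ - sum (λ u → a u w * x u)
  Qᵀ-at-zero x w xw≡0 = trans (Qᵀ-formula x w)
    (trans (cong (λ t → deg w * t - sum (λ u → a u w * x u)) xw≡0)
           (trans (cong (_- sum (λ u → a u w * x u)) (ℤP.*-zeroʳ (deg w))) (ℤP.+-identityˡ _)))

  inflow-nonNeg : ∀ (x : Fin n → ℤ) → (∀ u → + 0 ≤ x u) → ∀ w → + 0 ≤ sum (λ u → a u w * x u)
  inflow-nonNeg x 0≤x w = sum-nonNeg {f = λ u → a u w * x u} (λ u → *-nonNeg (a-nonNeg u w) (0≤x u))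

  Qᵀ-nonPos-at-zero : ∀ (x : Fin n → ℤ) → (∀ u → + 0 ≤ x u) → ∀ w → x w ≡ + 0 → Qᵀ x w ≤ + 0
  Qᵀ-nonPos-at-zero x 0≤x w xw≡0 =
    ℤP.≤-trans (ℤP.≤-reflexive (Qᵀ-at-zero x w xw≡0)) (ℤP.neg-mono-≤ (inflow-nonNeg x 0≤x w))

  Qᵀ-antitone-at : ∀ {p y} → (∀ u → p u ≤ y u) → ∀ w → p w ≡ y w → Qᵀ y w ≤ Qᵀ p w
  Qᵀ-antitone-at {p} {y} p≤y w pw≡yw = ℤP.i-j≤0⇒i≤j (subst (_≤ + 0) (Qᵀ-- y p w)
    (Qᵀ-nonPos-at-zero (λ u → y u - p u) (λ u → ℤP.i≤j⇒0≤j-i (p≤y u)) w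
      (trans (cong (_-_ (y w)) pw≡yw) (ℤP.+-inverseʳ (y w)))))

  kernel-positivity-spreads : ∀ (x : Fin n → ℤ) → (∀ u → + 0 ≤ x u) → (∀ w → Qᵀ x w ≡ + 0) →
    ∀ {u w} → Reach A u w → + 0 < x u → + 0 < x w
  kernel-positivity-spreads x 0≤x Qᵀx≡0 here 0<xu = 0<xu
  kernel-positivity-spreads x 0≤x Qᵀx≡0 (step {u} {v} 0<Auv v⇝w) 0<xu =
    kernel-positivity-spreads x 0≤x Qᵀx≡0 v⇝w 0<xv
    where
    0<xv : + 0 < x v
    0<xv with + 0 ℤP.<? x v
    ... | yes 0<xv = 0<xv
    ... | no  0≮xv = ⊥-elim (ℤP.<-irrefl refl (ℤP.<-≤-trans 0<inflow inflow≤0))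
      where
      xv≡0 : x v ≡ + 0
      xv≡0 = ℤP.≤-antisym (ℤP.≮⇒≥ 0≮xv) (0≤x v)
      0<inflow : + 0 < sum (λ u' → a u' v * x u')
      0<inflow = ℤP.<-≤-trans (*-pos (ℤ.+<+ 0<Auv) 0<xu)
                              (term≤sum (λ u' → *-nonNeg (a-nonNeg u' v) (0≤x u')) u)
      inflow≤0 : sum (λ u' → a u' v * x u') ≤ + 0
      inflow≤0 = ℤP.≤-reflexive (ℤP.neg-injective (trans (sym (Qᵀ-at-zero x v xv≡0)) (Qᵀx≡0 v)))

  Qᵀ-kernel-multiple : ∀ z f → (∀ w → Qᵀ f w ≡ + 0) → ∀ t w → Qᵀ (λ u → z u + t * f u) w ≡ Qᵀ z w
  Qᵀ-kernel-multiple z f Qᵀf≡0 t w = begin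
    Qᵀ (λ u → z u + t * f u) w     ≡⟨ Qᵀ-+ z (λ u → t * f u) w ⟩
    Qᵀ z w + Qᵀ (λ u → t * f u) w  ≡⟨ cong (_+_ (Qᵀ z w)) (Qᵀ-scale t f w) ⟩
    Qᵀ z w + t * Qᵀ f w            ≡⟨ cong (λ q → Qᵀ z w + t * q) (Qᵀf≡0 w) ⟩
    Qᵀ z w + t * + 0               ≡⟨ cong (_+_ (Qᵀ z w)) (ℤP.*-zeroʳ t) ⟩
    Qᵀ z w + + 0                   ≡⟨ ℤP.+-identityʳ (Qᵀ z w) ⟩
    Qᵀ z w                         ∎
    where open ≡-Reasoning

  nonNeg-preimage : ∀ f → (∀ u → + 0 < f u) → (∀ w → Qᵀ f w ≡ + 0) →
    ∀ z → Σ (Fin n → ℤ) λ y → (∀ u → + 0 ≤ y u) × (∀ w → Qᵀ y w ≡ Qᵀ z w)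
  nonNeg-preimage f 0<f Qᵀf≡0 z = (λ u → z u + ℓ¹ z * f u) , 0≤y , Qᵀ-kernel-multiple z f Qᵀf≡0 (ℓ¹ z)
    where
    0≤y : ∀ u → + 0 ≤ z u + ℓ¹ z * f u
    0≤y u = subst (_≤ z u + ℓ¹ z * f u) (ℤP.+-inverseʳ (z u))
      (ℤP.+-monoʳ-≤ (z u) (ℤP.≤-trans (-x≤ℓ¹ z u) (i≤i*j (ℓ¹-nonNeg z) (0<f u))))

  infix 4 _∼_
  record _∼_ (c d : ZV n) : Set where
    constructor ∼-via
    field
      witness    : Fin n → ℤ
      difference : ∀ w → lookup c w - lookup d w ≡ Qᵀ witness w

  image⇒∼ : ∀ {c d} → InImageQT A (zipWith _-_ c d) → c ∼ d
  image⇒∼ {c} {d} (z , c-d≡QTz) = ∼-via (lookup z) λ w →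
    trans (sym (VP.lookup-zipWith _-_ w c d)) (trans (cong (λ v → lookup v w) c-d≡QTz) (lookup-QT z w))

  image-of : ∀ {c} z → (∀ w → lookup c w ≡ Qᵀ z w) → InImageQT A c
  image-of {c} z c≡Qᵀz = tabulate z , vec-ext λ w →
    trans (c≡Qᵀz w) (sym (trans (lookup-QT (tabulate z) w) (Qᵀ-cong (VP.lookup∘tabulate z) w)))

  ∼⇒image : ∀ {c d} → c ∼ d → InImageQT A (zipWith _-_ c d)
  ∼⇒image {c} {d} (∼-via z c-d≡Qᵀz) = image-of z λ w → trans (VP.lookup-zipWith _-_ w c d) (c-d≡Qᵀz w)

  ∼-sym : ∀ {c d} → c ∼ d → d ∼ c
  ∼-sym {c} {d} (∼-via z c-d≡Qᵀz) = ∼-via (λ u → - z u) λ w → begin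
    lookup d w - lookup c w        ≡⟨ flip (lookup c w) (lookup d w) ⟩
    - (lookup c w - lookup d w)    ≡⟨ cong -_ (c-d≡Qᵀz w) ⟩
    - Qᵀ z w                       ≡⟨ Qᵀ-neg z w ⟨
    Qᵀ (λ u → - z u) w             ∎
    where
    open ≡-Reasoning
    flip : ∀ x y → y - x ≡ - (x - y)
    flip = solve-∀

  ∼-trans : ∀ {c d e} → c ∼ d → d ∼ e → c ∼ e
  ∼-trans {c} {d} {e} (∼-via z c-d≡Qᵀz) (∼-via z′ d-e≡Qᵀz′) = ∼-via (λ u → z u + z′ u) λ w → begin
    lookup c w - lookup e w                              ≡⟨ telescope (lookup c w) (lookup d w) (lookup e w) ⟩
    (lookup c w - lookup d w) + (lookup d w - lookup e w) ≡⟨ cong₂ _+_ (c-d≡Qᵀz w) (d-e≡Qᵀz′ w) ⟩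
    Qᵀ z w + Qᵀ z′ w                                     ≡⟨ Qᵀ-+ z z′ w ⟨
    Qᵀ (λ u → z u + z′ u) w                              ∎
    where
    open ≡-Reasoning
    telescope : ∀ x y z → x - z ≡ (x - y) + (y - z)
    telescope = solve-∀

  lookup-fire : ∀ c v w → lookup (fire A c v) w ≡ lookup c w - Qm A v w
  lookup-fire c v w = trans (VP.lookup-zipWith _-_ w c (QT A (hat v)))
    (cong (_-_ (lookup c w)) (trans (lookup-QT (hat v) w)
      (trans (Qᵀ-cong (lookup-hat v) w) (Qᵀ-δ v w))))

  sum-fire : ∀ c v → sumℤ (fire A c v) ≡ sumℤ c
  sum-fire c v = begin
    sumℤ (fire A c v)                          ≡⟨ sumℤ≡sum (fire A c v) ⟩
    sum (lookup (fire A c v))                  ≡⟨ sum-cong-≗ (lookup-fire c v) ⟩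
    sum (λ w → lookup c w - Qm A v w)          ≡⟨ sum-distrib-- (lookup c) (Qm A v) ⟩
    sum (lookup c) - sum (Qm A v)              ≡⟨ cong (_-_ (sum (lookup c))) (Q-rowSum v) ⟩
    sum (lookup c) - + 0                       ≡⟨ ℤP.+-identityʳ _ ⟩
    sum (lookup c)                             ≡⟨ sumℤ≡sum c ⟨
    sumℤ c                                     ∎
    where open ≡-Reasoning

  scale : ℕ → ZV n → ZV n
  scale k = V.map (+ k *_)

  lookup-scale : ∀ k u w → lookup (scale k u) w ≡ + k * lookup u w
  lookup-scale k u w = VP.lookup-map w (+ k *_) u

  sum-scale : ∀ k u → sumℤ (scale k u) ≡ + k * sumℤ u
  sum-scale k u = begin
    sumℤ (scale k u)                   ≡⟨ sumℤ≡sum (scale k u) ⟩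
    sum (lookup (scale k u))           ≡⟨ sum-cong-≗ (lookup-scale k u) ⟩
    sum (λ w → + k * lookup u w)       ≡⟨ *-distribˡ-sum (+ k) (lookup u) ⟨
    + k * sum (lookup u)               ≡⟨ cong (+ k *_) (sumℤ≡sum u) ⟨
    + k * sumℤ u                       ∎
    where open ≡-Reasoning

  sum-QT : ∀ z → sumℤ (QT A z) ≡ + 0
  sum-QT z = trans (sumℤ≡sum (QT A z)) (trans (sum-cong-≗ (lookup-QT z)) (sum-Qᵀ (lookup z)))

  torsion⇒config : ∀ u → IsTorsion A u → IsConfig u
  torsion⇒config u (k , 0<k , z , ku≡QTz)
    with ℤP.i*j≡0⇒i≡0∨j≡0 (+ k) (trans (sym (sum-scale k u)) (trans (cong sumℤ ku≡QTz) (sum-QT z)))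
  ... | inj₁ k≡0   = ⊥-elim (ℕP.<⇒≢ 0<k (sym (ℤP.+-injective k≡0)))
  ... | inj₂ sum≡0 = sum≡0

module Runs {n : ℕ} (A : Adj n) (b : Fin n) where
  open Laplacian A public

  data Legal (c : ZV n) : Fin n → Set where
    nonBank : ∀ {v} → LegalNonBank A b c v → Legal c v
    bank    : Stable A b c → Legal c b

  -- The bank may fire only at stable configurations, so both FireSeq and SuccIter embed into runs.
  data Run : ZV n → ZV n → Set where
    []  : ∀ {c} → Run c c
    _∷_ : ∀ {c d v} → Legal c v → Run (fire A c v) d → Run c d

  infixr 5 _∷_ _++_

  fired : ∀ {c d} → Run c d → Fin n → ℤ
  fired []                    w = + 0
  fired (_∷_ {v = v} _ r) w = δ v w + fired r w

  _++_ : ∀ {c d e} → Run c d → Run d e → Run c e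
  []      ++ s = s
  (l ∷ r) ++ s = l ∷ (r ++ s)

  fired-++ : ∀ {c d e} (r : Run c d) (s : Run d e) w → fired (r ++ s) w ≡ fired r w + fired s w
  fired-++ []                  s w = sym (ℤP.+-identityˡ _)
  fired-++ (_∷_ {v = v} _ r) s w =
    trans (cong (_+_ (δ v w)) (fired-++ r s w)) (sym (ℤP.+-assoc (δ v w) _ _))

  fired-nonNeg : ∀ {c d} (r : Run c d) w → + 0 ≤ fired r w
  fired-nonNeg []                  w = ℤP.≤-refl
  fired-nonNeg (_∷_ {v = v} _ r) w = ℤP.+-mono-≤ (δ-nonNeg v w) (fired-nonNeg r w)

  run-result : ∀ {c d} (r : Run c d) w → lookup d w ≡ lookup c w - Qᵀ (fired r) w
  run-result {c} [] w = sym (trans (cong (_-_ (lookup c w)) (Qᵀ-zero w)) (ℤP.+-identityʳ _))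
  run-result {c} (_∷_ {v = v} _ r) w = begin
    _                                               ≡⟨ run-result r w ⟩
    lookup (fire A c v) w - Qᵀ (fired r) w          ≡⟨ cong (_- Qᵀ (fired r) w) (lookup-fire c v w) ⟩
    lookup c w - Qm A v w - Qᵀ (fired r) w          ≡⟨ regroup (lookup c w) (Qm A v w) (Qᵀ (fired r) w) ⟩
    lookup c w - (Qm A v w + Qᵀ (fired r) w)
      ≡⟨ cong (λ t → lookup c w - (t + Qᵀ (fired r) w)) (Qᵀ-δ v w) ⟨
    lookup c w - (Qᵀ (δ v) w + Qᵀ (fired r) w)      ≡⟨ cong (_-_ (lookup c w)) (Qᵀ-+ (δ v) (fired r) w) ⟨
    lookup c w - Qᵀ (λ u → δ v u + fired r u) w     ∎
    where
    open ≡-Reasoning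
    regroup : ∀ x y z → x - y - z ≡ x - (y + z)
    regroup = solve-∀

  run⇒∼ : ∀ {c d} → Run c d → c ∼ d
  run⇒∼ {c} {d} r = ∼-via (fired r) λ w →
    trans (cong (_-_ (lookup c w)) (run-result r w)) (cancel (lookup c w) (Qᵀ (fired r) w))
    where
    cancel : ∀ x q → x - (x - q) ≡ q
    cancel = solve-∀

  loop-in-kernel : ∀ {c} (r : Run c c) w → Qᵀ (fired r) w ≡ + 0
  loop-in-kernel {c} r w = trans (sym (_∼_.difference (run⇒∼ r) w)) (ℤP.+-inverseʳ (lookup c w))

  sum-run : ∀ {c d} → Run c d → sumℤ d ≡ sumℤ c
  sum-run []                      = refl
  sum-run {c} (_∷_ {v = v} _ r) = trans (sum-run r) (sum-fire c v)

  fromFireSeq : ∀ {c d} → FireSeq A b c d → Run c d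
  fromFireSeq done         = []
  fromFireSeq (step _ l f) = nonBank l ∷ fromFireSeq f

  fired-fromFireSeq-bank : ∀ {c d} (f : FireSeq A b c d) → fired (fromFireSeq f) b ≡ + 0
  fired-fromFireSeq-bank done               = refl
  fired-fromFireSeq-bank (step _ (v≢b , _) f) =
    cong₂ _+_ (δ-≢ v≢b) (fired-fromFireSeq-bank f)

  fromSuccIter : ∀ {m c d} → SuccIter A b m c d → Run c d
  fromSuccIter zero                      = []
  fromSuccIter (suc (st , fs , _) rest) = bank st ∷ fromFireSeq fs ++ fromSuccIter rest

  fired-fromSuccIter-bank : ∀ {m c d} (s : SuccIter A b m c d) → fired (fromSuccIter s) b ≡ + m
  fired-fromSuccIter-bank zero = refl
  fired-fromSuccIter-bank {suc m} (suc (st , fs , _) rest) = begin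
    δ b b + fired (fromFireSeq fs ++ fromSuccIter rest) b
      ≡⟨ cong₂ _+_ (δ-refl b) (fired-++ (fromFireSeq fs) (fromSuccIter rest) b) ⟩
    + 1 + (fired (fromFireSeq fs) b + fired (fromSuccIter rest) b)
      ≡⟨ cong (_+_ (+ 1)) (cong₂ _+_ (fired-fromFireSeq-bank fs) (fired-fromSuccIter-bank rest)) ⟩
    + 1 + (+ 0 + + m)
      ≡⟨ ℤP.pos-+ 1 m ⟨
    + suc m ∎
    where open ≡-Reasoning

  repeat : ∀ {c} → ℕ → Run c c → Run c c
  repeat zero    r = []
  repeat (suc k) r = r ++ repeat k r

  fired-repeat : ∀ {c} k (r : Run c c) w → fired (repeat k r) w ≡ + k * fired r w
  fired-repeat zero    r w = sym (ℤP.*-zeroˡ (fired r w))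
  fired-repeat (suc k) r w = begin
    fired (r ++ repeat k r) w          ≡⟨ fired-++ r (repeat k r) w ⟩
    fired r w + fired (repeat k r) w   ≡⟨ cong (_+_ (fired r w)) (fired-repeat k r w) ⟩
    fired r w + + k * fired r w        ≡⟨ factor (fired r w) (+ k) ⟩
    (+ 1 + + k) * fired r w            ≡⟨ cong (_* fired r w) (ℤP.pos-+ 1 k) ⟨
    + suc k * fired r w                ∎
    where
    open ≡-Reasoning
    factor : ∀ x k → x + k * x ≡ (+ 1 + k) * x
    factor = solve-∀

  stableAt? : ∀ c v → Dec (v ≢ b → ℤ.suc (lookup c v) ≤ deg v)
  stableAt? c v with v ≟ b | ℤ.suc (lookup c v) ℤP.≤? deg v
  ... | yes v≡b | _         = yes (λ v≢b → ⊥-elim (v≢b v≡b))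
  ... | no  _   | yes c<deg = yes (λ _ → c<deg)
  ... | no  v≢b | no  c≮deg = no (λ stable → c≮deg (stable v≢b))

  stable-or-legal : ∀ c → Stable A b c ⊎ Σ (Fin n) (LegalNonBank A b c)
  stable-or-legal c with FP.all? (stableAt? c)
  ... | yes stable = inj₁ stable
  ... | no ¬stable with FP.¬∀⟶∃¬ n _ (stableAt? c) ¬stable
  ...   | v , ¬stableAt = inj₂ (v , v≢b , ℤP.≮⇒≥ (λ c<deg → ¬stableAt (λ _ → ℤP.i<j⇒suc[i]≤j c<deg)))
    where
    v≢b : v ≢ b
    v≢b v≡b = ¬stableAt (λ v≢b → ⊥-elim (v≢b v≡b))

  BoundedBelow : ℤ → ZV n → Set
  BoundedBelow m c = ∀ v → v ≢ b → m ≤ lookup c v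

  StableFun : (Fin n → ℤ) → Set
  StableFun x = ∀ v → v ≢ b → x v < deg v

  stable⇒StableFun : ∀ {c} → Stable A b c → StableFun (lookup c)
  stable⇒StableFun st v v≢b = ℤP.suc[i]≤j⇒i<j (st v v≢b)

  legal-firing-below : ∀ {e v} → Legal e v → ∀ c (p y : Fin n → ℤ) →
    (∀ w → lookup e w ≡ lookup c w - Qᵀ p w) → (∀ w → p w ≤ y w) → p b + δ v b ≤ y b →
    StableFun (λ u → lookup c u - Qᵀ y u) → p v < y v
  legal-firing-below (bank _) c p y _ _ pb+1≤yb _ =
    ℤP.suc[i]≤j⇒i<j (subst (_≤ y b) (trans (cong (_+_ (p b)) (δ-refl b)) (ℤP.+-comm (p b) (+ 1))) pb+1≤yb)
  legal-firing-below {e} {v} (nonBank (v≢b , deg≤ev)) c p y e≡ p≤y _ stable with p v ℤP.<? y v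
  ... | yes pv<yv = pv<yv
  ... | no  pv≮yv = ⊥-elim (ℤP.<-irrefl refl (ℤP.≤-<-trans deg≤ev (ℤP.≤-<-trans ev≤ (stable v v≢b))))
    where
    ev≤ : lookup e v ≤ lookup c v - Qᵀ y v
    ev≤ = subst (_≤ _) (sym (e≡ v)) (ℤP.+-monoʳ-≤ (lookup c v) (ℤP.neg-mono-≤
            (Qᵀ-antitone-at p≤y v (ℤP.≤-antisym (p≤y v) (ℤP.≮⇒≥ pv≮yv)))))

  fire-shift : ∀ {e} c p v → (∀ w → lookup e w ≡ lookup c w - Qᵀ p w) →
    ∀ w → lookup (fire A e v) w ≡ lookup c w - Qᵀ (λ u → p u + δ v u) w
  fire-shift {e} c p v e≡ w = begin
    lookup (fire A e v) w                   ≡⟨ lookup-fire e v w ⟩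
    lookup e w - Qm A v w                   ≡⟨ cong (_- Qm A v w) (e≡ w) ⟩
    lookup c w - Qᵀ p w - Qm A v w          ≡⟨ regroup (lookup c w) (Qᵀ p w) (Qm A v w) ⟩
    lookup c w - (Qᵀ p w + Qm A v w)        ≡⟨ cong (λ t → lookup c w - (Qᵀ p w + t)) (Qᵀ-δ v w) ⟨
    lookup c w - (Qᵀ p w + Qᵀ (δ v) w)      ≡⟨ cong (_-_ (lookup c w)) (Qᵀ-+ p (δ v) w) ⟨
    lookup c w - Qᵀ (λ u → p u + δ v u) w   ∎
    where
    open ≡-Reasoning
    regroup : ∀ x y z → x - y - z ≡ x - (y + z)
    regroup = solve-∀

  -- Generalised over the firing vector p spent before r, for the induction.
  leastAction-from : ∀ {e d} (r : Run e d) c (p y : Fin n → ℤ) →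
    (∀ w → lookup e w ≡ lookup c w - Qᵀ p w) → (∀ w → p w ≤ y w) → p b + fired r b ≤ y b →
    StableFun (λ u → lookup c u - Qᵀ y u) → ∀ w → p w + fired r w ≤ y w
  leastAction-from [] c p y _ p≤y _ _ w = subst (_≤ y w) (sym (ℤP.+-identityʳ (p w))) (p≤y w)
  leastAction-from {e} (_∷_ {v = v} l r) c p y e≡ p≤y hb stable w =
    subst (_≤ y w) (ℤP.+-assoc (p w) (δ v w) (fired r w))
      (leastAction-from r c p′ y (fire-shift {e} c p v e≡) p′≤y hb′ stable w)
    where
    p′ : Fin n → ℤ
    p′ u = p u + δ v u
    hb′ : p′ b + fired r b ≤ y b
    hb′ = subst (_≤ y b) (sym (ℤP.+-assoc (p b) (δ v b) (fired r b))) hb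
    p′b≤yb : p′ b ≤ y b
    p′b≤yb = ℤP.≤-trans (ℤP.i≤i+j (p′ b) (fired r b) {{ℤ.nonNegative (fired-nonNeg r b)}}) hb′
    p′≤y : ∀ u → p′ u ≤ y u
    p′≤y u = by-cases (v ≟ u)
      where
      by-cases : Dec (v ≡ u) → p′ u ≤ y u
      by-cases (yes refl) = subst (_≤ y v) (trans (ℤP.+-comm (+ 1) (p v)) (cong (_+_ (p v)) (sym (δ-refl v))))
                              (ℤP.i<j⇒suc[i]≤j (legal-firing-below l c p y e≡ p≤y p′b≤yb stable))
      by-cases (no v≢u)   = subst (_≤ y u) (trans (sym (ℤP.+-identityʳ (p u))) (cong (_+_ (p u)) (sym (δ-≢ v≢u))))
                              (p≤y u)

  leastAction : ∀ {c d} (r : Run c d) (y : Fin n → ℤ) → (∀ w → + 0 ≤ y w) → fired r b ≤ y b →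
    StableFun (λ u → lookup c u - Qᵀ y u) → ∀ w → fired r w ≤ y w
  leastAction {c} r y 0≤y hb stable w =
    subst (_≤ y w) (ℤP.+-identityˡ (fired r w))
      (leastAction-from r c (λ _ → + 0) y c≡c-0 0≤y (subst (_≤ y b) (sym (ℤP.+-identityˡ _)) hb) stable w)
    where
    c≡c-0 : ∀ w → lookup c w ≡ lookup c w - Qᵀ (λ _ → + 0) w
    c≡c-0 w = sym (trans (cong (_-_ (lookup c w)) (Qᵀ-zero w)) (ℤP.+-identityʳ _))

  fire-other-≥ : ∀ c {u v} → u ≢ v → lookup c v ≤ lookup (fire A c u) v
  fire-other-≥ c {u} {v} u≢v = ℤP.≤-trans (ℤP.i≤i+j (lookup c v) (a u v))
    (ℤP.≤-reflexive (sym (trans (lookup-fire c u v)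
      (trans (cong (_-_ (lookup c v)) (Qm-offDiagonal u≢v)) (cong (_+_ (lookup c v)) (ℤP.neg-involutive (a u v)))))))

  fire-self-nonNeg : ∀ {c v} → LegalNonBank A b c v → + 0 ≤ lookup (fire A c v) v
  fire-self-nonNeg {c} {v} (_ , deg≤cv) = subst (+ 0 ≤_) (sym after-firing)
    (ℤP.+-mono-≤ (ℤP.i≤j⇒0≤j-i deg≤cv) (a-nonNeg v v))
    where
    after-firing : lookup (fire A c v) v ≡ (lookup c v - deg v) + a v v
    after-firing = trans (lookup-fire c v v)
      (trans (cong (_-_ (lookup c v)) (Qm-diagonal v)) (regroup (lookup c v) (deg v) (a v v)))
      where
      regroup : ∀ x y z → x - (y - z) ≡ (x - y) + z
      regroup = solve-∀

  lowerBound-preserved : ∀ {c d} (r : Run c d) v → v ≢ b → ∀ m → m ≤ + 0 →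
    m ≤ lookup c v → m ≤ lookup d v
  lowerBound-preserved []                        v v≢b m m≤0 m≤cv = m≤cv
  lowerBound-preserved {c} (bank _ ∷ r)          v v≢b m m≤0 m≤cv =
    lowerBound-preserved r v v≢b m m≤0 (ℤP.≤-trans m≤cv (fire-other-≥ c (v≢b ∘ sym)))
  lowerBound-preserved {c} (_∷_ {v = u} (nonBank l) r) v v≢b m m≤0 m≤cv with u ≟ v
  ... | yes refl = lowerBound-preserved r v v≢b m m≤0 (ℤP.≤-trans m≤0 (fire-self-nonNeg {c} l))
  ... | no  u≢v  = lowerBound-preserved r v v≢b m m≤0 (ℤP.≤-trans m≤cv (fire-other-≥ c u≢v))

  unfired-first : ∀ {u v : Fin n} {k} → u ≢ v → + 0 < δ u v + k → + 0 < k
  unfired-first {k = k} u≢v = subst (+ 0 <_) (trans (cong (_+ k) (δ-≢ u≢v)) (ℤP.+-identityˡ k))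

  fired⇒nonNeg : ∀ {c d} (r : Run c d) v → v ≢ b → + 0 < fired r v → + 0 ≤ lookup d v
  fired⇒nonNeg [] v v≢b (ℤ.+<+ ())
  fired⇒nonNeg (bank _ ∷ r) v v≢b 0<fired = fired⇒nonNeg r v v≢b (unfired-first (v≢b ∘ sym) 0<fired)
  fired⇒nonNeg {c} {d} (_∷_ {v = u} (nonBank l) r) v v≢b 0<fired = by-cases (u ≟ v)
    where
    by-cases : Dec (u ≡ v) → + 0 ≤ lookup d v
    by-cases (yes refl) = lowerBound-preserved r u v≢b (+ 0) ℤP.≤-refl (fire-self-nonNeg {c} l)
    by-cases (no  u≢v)  = fired⇒nonNeg r v v≢b (unfired-first u≢v 0<fired)

module Stabilization {n : ℕ} (A : Adj n) (b : Fin n) (toBank : ∀ v → Reach A v b) where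
  open Runs A b public

  WalkToBank : ℕ → Fin n → Set
  WalkToBank zero    v = v ≡ b
  WalkToBank (suc k) v = Σ (Fin n) λ w → 0 ℕ.< A v w × WalkToBank k w

  walkToBank? : ∀ k v → Dec (WalkToBank k v)
  walkToBank? zero    v = v ≟ b
  walkToBank? (suc k) v = FP.any? (λ w → (0 ℕ.<? A v w) ×-dec walkToBank? k w)

  reach⇒walk : ∀ {v} → Reach A v b → Σ ℕ λ k → WalkToBank k v
  reach⇒walk here = 0 , refl
  reach⇒walk (step {v = w} 0<Avw w⇝b) with reach⇒walk w⇝b
  ... | k , walk = suc k , w , 0<Avw , walk

  shortestWalk : ∀ v → Σ ℕ λ k → WalkToBank k v × (∀ j → WalkToBank j v → k ℕ.≤ j)
  shortestWalk v = least-witness (λ k → walkToBank? k v) _ (proj₂ (reach⇒walk (toBank v)))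

  dist : Fin n → ℕ
  dist v = proj₁ (shortestWalk v)

  dist-bank : dist b ≡ 0
  dist-bank = ℕP.n≤0⇒n≡0 (proj₂ (proj₂ (shortestWalk b)) 0 refl)

  dist-descent : ∀ v → v ≢ b → Σ (Fin n) λ w → 0 ℕ.< A v w × dist w ℕ.< dist v
  dist-descent v v≢b with shortestWalk v
  ... | zero  , v≡b , _ = ⊥-elim (v≢b v≡b)
  ... | suc k , (w , 0<Avw , walk) , _ = w , 0<Avw , s≤s (proj₂ (proj₂ (shortestWalk w)) k walk)

  base : ℕ
  base = suc totalDeg

  distBound : ℕ
  distBound = sumℕ dist

  -- ψ gains a factor base > outdegree per step towards the bank, so Qφ is positive off the bank.
  ψ : Fin n → ℕ
  ψ v = base ℕ.^ (distBound ℕ.∸ dist v)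

  φ : Fin n → ℤ
  φ v = + (base ℕ.^ distBound) - + ψ v

  φ-nonNeg : ∀ v → + 0 ≤ φ v
  φ-nonNeg v = ℤP.i≤j⇒0≤j-i (ℤ.+≤+ (ℕP.^-monoʳ-≤ base (ℕP.m∸n≤m distBound (dist v))))

  φ-bank : φ b ≡ + 0
  φ-bank = trans (cong (λ d → + (base ℕ.^ distBound) - + (base ℕ.^ (distBound ℕ.∸ d))) dist-bank)
                 (ℤP.+-inverseʳ (+ (base ℕ.^ distBound)))

  descent-outweighs : ∀ v → v ≢ b →
    Σ (Fin n) λ w → 0 ℕ.< A v w × suc (outdeg A v ℕ.* ψ v) ℕ.≤ A v w ℕ.* ψ w
  descent-outweighs v v≢b with dist-descent v v≢b
  ... | w , 0<Avw , dw<dv = w , 0<Avw , (begin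
    suc (outdeg A v ℕ.* ψ v)         ≤⟨ ℕP.+-monoˡ-≤ _ (ℕP.m^n>0 base (distBound ℕ.∸ dist v)) ⟩
    suc (outdeg A v) ℕ.* ψ v         ≤⟨ ℕP.*-monoˡ-≤ (ψ v) (s≤s (term≤sumℕ (outdeg A) v)) ⟩
    base ℕ.^ suc (distBound ℕ.∸ dist v)    ≤⟨ ℕP.^-monoʳ-≤ base (ℕP.∸-monoʳ-< dw<dv (term≤sumℕ dist v)) ⟩
    ψ w                              ≤⟨ ℕP.m≤n*m (ψ w) (A v w) {{ℕ.>-nonZero 0<Avw}} ⟩
    A v w ℕ.* ψ w                    ∎)
    where open ℕP.≤-Reasoning

  Qφ : Fin n → ℤ
  Qφ v = sum (λ w → Qm A v w * φ w)

  Qφ-formula : ∀ v → Qφ v ≡ sum (λ w → a v w * + ψ w) - deg v * + ψ v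
  Qφ-formula v = begin
    Qφ v
      ≡⟨ Q-row-formula φ v ⟩
    deg v * φ v - sum (λ w → a v w * φ w)
      ≡⟨ cong (_-_ (deg v * φ v)) inflow ⟩
    deg v * φ v - (K * deg v - S)
      ≡⟨ cancel (deg v) K (+ ψ v) S ⟩
    S - deg v * + ψ v ∎
    where
    open ≡-Reasoning
    K S : ℤ
    K = + (base ℕ.^ distBound)
    S = sum (λ w → a v w * + ψ w)
    inflow : sum (λ w → a v w * φ w) ≡ K * deg v - S
    inflow = begin
      sum (λ w → a v w * φ w)                   ≡⟨ sum-cong-≗ (λ w → split (a v w) K (+ ψ w)) ⟩
      sum (λ w → K * a v w - a v w * + ψ w)     ≡⟨ sum-distrib-- (λ w → K * a v w) (λ w → a v w * + ψ w) ⟩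
      sum (λ w → K * a v w) - S                 ≡⟨ cong (_- S) (*-distribˡ-sum K (a v)) ⟨
      K * sum (a v) - S                         ≡⟨ cong (λ t → K * t - S) (deg≡sum v) ⟨
      K * deg v - S                             ∎
      where
      split : ∀ e k p → e * (k - p) ≡ k * e - e * p
      split = solve-∀
    cancel : ∀ d k p s → d * (k - p) - (k * d - s) ≡ s - d * p
    cancel = solve-∀

  Qφ-pos : ∀ v → v ≢ b → + 1 ≤ Qφ v
  Qφ-pos v v≢b with descent-outweighs v v≢b
  ... | w , _ , outweighs = subst (+ 1 ≤_) (sym (Qφ-formula v)) (1+i≤j⇒1≤j-i (begin
    + 1 + deg v * + ψ v                ≡⟨ cong (_+_ (+ 1)) (ℤP.pos-* (outdeg A v) (ψ v)) ⟨
    + suc (outdeg A v ℕ.* ψ v)         ≤⟨ ℤ.+≤+ outweighs ⟩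
    + (A v w ℕ.* ψ w)                  ≡⟨ ℤP.pos-* (A v w) (ψ w) ⟩
    a v w * + ψ w                      ≤⟨ term≤sum (λ u → *-nonNeg (a-nonNeg v u) (ℤ.+≤+ z≤n)) w ⟩
    sum (λ u → a v u * + ψ u)          ∎))
    where open ℤP.≤-Reasoning

  Φ : ZV n → ℤ
  Φ c = sum (λ w → φ w * lookup c w)

  Φ-fire : ∀ c v → Φ (fire A c v) ≡ Φ c - Qφ v
  Φ-fire c v = begin
    sum (λ w → φ w * lookup (fire A c v) w)
      ≡⟨ sum-cong-≗ (λ w → trans (cong (φ w *_) (lookup-fire c v w)) (distribute (φ w) (lookup c w) (Qm A v w))) ⟩
    sum (λ w → φ w * lookup c w - Qm A v w * φ w)
      ≡⟨ sum-distrib-- (λ w → φ w * lookup c w) (λ w → Qm A v w * φ w) ⟩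
    Φ c - Qφ v ∎
    where
    open ≡-Reasoning
    distribute : ∀ f x q → f * (x - q) ≡ f * x - q * f
    distribute = solve-∀

  Φ-decreases : ∀ c v → v ≢ b → Φ (fire A c v) < Φ c
  Φ-decreases c v v≢b = subst₂ _<_ (sym (Φ-fire c v)) (ℤP.+-identityʳ (Φ c))
    (ℤP.+-monoʳ-< (Φ c) (ℤP.neg-mono-< (ℤP.suc[i]≤j⇒i<j {+ 0} (Qφ-pos v v≢b))))

  Φ-lowerBound : ∀ m c → BoundedBelow m c → m * sum φ ≤ Φ c
  Φ-lowerBound m c bounded =
    subst (_≤ Φ c) (trans (sum-cong-≗ (λ w → ℤP.*-comm (φ w) m)) (sym (*-distribˡ-sum m φ))) (sum-mono-≤ weighted)
    where
    weighted : ∀ w → φ w * m ≤ φ w * lookup c w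
    weighted w with w ≟ b
    ... | yes refl = ℤP.≤-reflexive (trans (cong (_* m) φ-bank) (sym (cong (_* lookup c b) φ-bank)))
    ... | no  w≢b  = ℤP.*-monoˡ-≤-nonNeg (φ w) {{ℤ.nonNegative (φ-nonNeg w)}} (bounded w w≢b)

  stabilize-within : ∀ m k c → m ≤ + 0 → BoundedBelow m c → Φ c - m * sum φ ≤ + k →
    Σ (ZV n) (Stabilizes A b c)
  stabilize-within m k c m≤0 bounded h≤k with stable-or-legal c
  ... | inj₁ stable  = c , done , stable
  ... | inj₂ (v , l@(v≢b , _)) = continue k h≤k
    where
    bounded′ : BoundedBelow m (fire A c v)
    bounded′ u u≢b = lowerBound-preserved ((Legal c v ∋ nonBank l) ∷ []) u u≢b m m≤0 (bounded u u≢b)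
    drop : Φ (fire A c v) - m * sum φ < Φ c - m * sum φ
    drop = ℤP.+-monoˡ-< (- (m * sum φ)) (Φ-decreases c v v≢b)
    continue : ∀ k → Φ c - m * sum φ ≤ + k → Σ (ZV n) (Stabilizes A b c)
    continue zero    h≤0 = ⊥-elim (ℤP.<-irrefl refl
      (ℤP.<-≤-trans (ℤP.≤-<-trans (ℤP.i≤j⇒0≤j-i (Φ-lowerBound m (fire A c v) bounded′)) drop) h≤0))
    continue (suc k) h≤1+k =
      extend (stabilize-within m k (fire A c v) m≤0 bounded′ (ℤP.i<j⇒i≤pred[j] (ℤP.<-≤-trans drop h≤1+k)))
      where
      extend : Σ (ZV n) (Stabilizes A b (fire A c v)) → Σ (ZV n) (Stabilizes A b c)
      extend (d , fs , stable) = d , step v l fs , stable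

  stabilize : ∀ c → Σ (ZV n) (Stabilizes A b c)
  stabilize c = stabilize-within m ℤ.∣ Φ c - m * sum φ ∣ c (ℤP.neg-mono-≤ (ℓ¹-nonNeg (lookup c))) bounded
    (ℤP.≤-reflexive (sym (ℤP.0≤i⇒+∣i∣≡i (ℤP.i≤j⇒0≤j-i (Φ-lowerBound m c bounded)))))
    where
    m : ℤ
    m = - ℓ¹ (lookup c)
    bounded : BoundedBelow m c
    bounded v _ = -ℓ¹≤ (lookup c) v

module Pigeonhole {n : ℕ} (b : Fin n) where

  agree-off-bank : ∀ {c d : ZV n} → (∀ v → v ≢ b → lookup c v ≡ lookup d v) → sumℤ c ≡ sumℤ d →
    c ≡ d
  agree-off-bank {c} {d} agree same-sum = vec-ext agree-everywhere
    where
    g : Fin n → ℤ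
    g u = lookup c u - lookup d u
    g-supported-at-bank : ∀ u → δ b u * g u ≡ g u
    g-supported-at-bank u with b ≟ u
    ... | yes refl = ℤP.*-identityˡ (g u)
    ... | no  b≢u  = trans (ℤP.*-zeroˡ (g u))
      (sym (trans (cong (_- lookup d u) (agree u (b≢u ∘ sym))) (ℤP.+-inverseʳ (lookup d u))))
    g-bank : g b ≡ + 0
    g-bank = begin
      g b                                ≡⟨ sum-δ b g ⟨
      sum (λ u → δ b u * g u)            ≡⟨ sum-cong-≗ g-supported-at-bank ⟩
      sum g                              ≡⟨ sum-distrib-- (lookup c) (lookup d) ⟩
      sum (lookup c) - sum (lookup d)    ≡⟨ cong₂ _-_ (sumℤ≡sum c) (sumℤ≡sum d) ⟨
      sumℤ c - sumℤ d                    ≡⟨ cong (_- sumℤ d) same-sum ⟩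
      sumℤ d - sumℤ d                    ≡⟨ ℤP.+-inverseʳ (sumℤ d) ⟩
      + 0                                ∎
      where open ≡-Reasoning
    agree-everywhere : ∀ u → lookup c u ≡ lookup d u
    agree-everywhere u with u ≟ b
    ... | yes refl = ℤP.i-j≡0⇒i≡j _ _ g-bank
    ... | no  u≢b  = agree u u≢b

  Boxed : ℤ → ℤ → ZV n → Set
  Boxed m M c = ∀ v → v ≢ b → m ≤ lookup c v × lookup c v ≤ M

  -- Off the bank, F i is recorded by the digits |F i v - m| ≤ W; the bank entry is fixed by the sum.
  boxed-sequence-repeats : ∀ m M s (F : ℕ → ZV n) → (∀ i → sumℤ (F i) ≡ s) → (∀ i → Boxed m M (F i)) →
    ∃₂ λ i j → i ℕ.< j × F i ≡ F j
  boxed-sequence-repeats m M s F same-sum boxed =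
    repetition (FP.pigeonhole (ℕP.n<1+n (suc W ℕ.^ n)) (λ i → F.funToFin (digits (toℕ i))))
    where
    W : ℕ
    W = ℤ.∣ M - m ∣
    clamp : ℕ → Fin (suc W)
    clamp x = F.fromℕ< (s≤s (ℕP.m⊓n≤n x W))
    digits : ℕ → Fin n → Fin (suc W)
    digits i v = clamp ℤ.∣ lookup (F i) v - m ∣
    digit≡offset : ∀ i v → v ≢ b → + toℕ (digits i v) ≡ lookup (F i) v - m
    digit≡offset i v v≢b = begin
      + toℕ (digits i v)
        ≡⟨ cong +_ (trans (FP.toℕ-fromℕ< _) (ℕP.m≤n⇒m⊓n≡m (ℤP.drop‿+≤+ offset≤W))) ⟩
      + ℤ.∣ lookup (F i) v - m ∣  ≡⟨ ℤP.0≤i⇒+∣i∣≡i 0≤offset ⟩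
      lookup (F i) v - m          ∎
      where
      open ≡-Reasoning
      0≤offset : + 0 ≤ lookup (F i) v - m
      0≤offset = ℤP.i≤j⇒0≤j-i (proj₁ (boxed i v v≢b))
      offset≤W : + ℤ.∣ lookup (F i) v - m ∣ ≤ + W
      offset≤W = subst₂ _≤_ (sym (ℤP.0≤i⇒+∣i∣≡i 0≤offset))
                            (sym (ℤP.0≤i⇒+∣i∣≡i (ℤP.≤-trans 0≤offset offset≤M-m))) offset≤M-m
        where
        offset≤M-m : lookup (F i) v - m ≤ M - m
        offset≤M-m = ℤP.+-monoˡ-≤ (- m) (proj₂ (boxed i v v≢b))
    repetition : ∃₂ (λ i j → i F.< j × F.funToFin (digits (toℕ i)) ≡ F.funToFin (digits (toℕ j))) →
                 ∃₂ λ i j → i ℕ.< j × F i ≡ F j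
    repetition (i , j , i<j , same-code) =
      toℕ i , toℕ j , i<j , agree-off-bank same-offset (trans (same-sum (toℕ i)) (sym (same-sum (toℕ j))))
      where
      same-offset : ∀ v → v ≢ b → lookup (F (toℕ i)) v ≡ lookup (F (toℕ j)) v
      same-offset v v≢b = begin
        lookup (F (toℕ i)) v              ≡⟨ restore (lookup (F (toℕ i)) v) m ⟨
        lookup (F (toℕ i)) v - m + m      ≡⟨ cong (_+ m) same-offset′ ⟩
        lookup (F (toℕ j)) v - m + m      ≡⟨ restore (lookup (F (toℕ j)) v) m ⟩
        lookup (F (toℕ j)) v              ∎
        where
        open ≡-Reasoning
        same-digit : digits (toℕ i) v ≡ digits (toℕ j) v
        same-digit = trans (sym (FP.finToFun-funToFin (digits (toℕ i)) v))
                           (trans (cong (λ k → F.finToFun k v) same-code) (FP.finToFun-funToFin (digits (toℕ j)) v))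
        same-offset′ : lookup (F (toℕ i)) v - m ≡ lookup (F (toℕ j)) v - m
        same-offset′ = trans (sym (digit≡offset (toℕ i) v v≢b))
                             (trans (cong (+_ ∘ toℕ) same-digit) (digit≡offset (toℕ j) v v≢b))
        restore : ∀ x m → x - m + m ≡ x
        restore = solve-∀

module Dynamics {n : ℕ} (A : Adj n) (b : Fin n) (sc : StronglyConnected A) where
  open Stabilization A b (λ v → sc v b) public
  open Pigeonhole b

  successor : ∀ c → Stable A b c → Σ (ZV n) (Succ A b c)
  successor c stable = proj₁ (stabilize (fire A c b)) , stable , proj₂ (stabilize (fire A c b))

  snocˢ : ∀ {m c d e} → SuccIter A b m c d → Succ A b d e → SuccIter A b (suc m) c e
  snocˢ zero            last = suc last zero
  snocˢ (suc succ iter) last = suc succ (snocˢ iter last)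

  iterate : ∀ j c → Stable A b c → Σ (ZV n) λ d → SuccIter A b j c d × Stable A b d
  iterate zero    c stable = c , zero , stable
  iterate (suc j) c stable with successor c stable
  ... | d , succ with iterate j d (proj₂ (proj₂ succ))
  ...   | e , iter , stable′ = e , suc succ iter , stable′

  stable⇒≤totalDeg : ∀ {c} → Stable A b c → ∀ v → v ≢ b → lookup c v ≤ + totalDeg
  stable⇒≤totalDeg {c} stable v v≢b =
    ℤP.<⇒≤ (ℤP.<-≤-trans (stable⇒StableFun {c} stable v v≢b) (deg≤totalDeg v))

  eventually-critical : ∀ s → Stable A b s → IsConfig s → Σ (ZV n) λ c → Critical A b c × Coeval A b s c
  eventually-critical s stable config =
    critical-in (boxed-sequence-repeats m (+ totalDeg) (+ 0) O orbit-config orbit-boxed)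
    where
    orbit : ℕ → Σ (ZV n) (Stable A b)
    orbit zero    = s , stable
    orbit (suc i) = next (orbit i)
      where
      next : Σ (ZV n) (Stable A b) → Σ (ZV n) (Stable A b)
      next (c , stable) = proj₁ (successor c stable) , proj₂ (proj₂ (proj₂ (successor c stable)))
    O : ℕ → ZV n
    O i = proj₁ (orbit i)
    orbit-step : ∀ i → Succ A b (O i) (O (suc i))
    orbit-step i = proj₂ (successor (O i) (proj₂ (orbit i)))
    orbit-prefix : ∀ i → SuccIter A b i s (O i)
    orbit-prefix zero    = zero
    orbit-prefix (suc i) = snocˢ (orbit-prefix i) (orbit-step i)
    orbit-segment : ∀ i k → SuccIter A b k (O i) (O (k ℕ.+ i))
    orbit-segment i zero    = zero
    orbit-segment i (suc k) = snocˢ (orbit-segment i k) (orbit-step (k ℕ.+ i))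
    m : ℤ
    m = - ℓ¹ (lookup s)
    orbit-config : ∀ i → IsConfig (O i)
    orbit-config i = trans (sum-run (fromSuccIter (orbit-prefix i))) config
    orbit-boxed : ∀ i → Boxed m (+ totalDeg) (O i)
    orbit-boxed i v v≢b =
      lowerBound-preserved (fromSuccIter (orbit-prefix i)) v v≢b m (ℤP.neg-mono-≤ (ℓ¹-nonNeg (lookup s)))
                           (-ℓ¹≤ (lookup s) v) ,
      stable⇒≤totalDeg {O i} (proj₂ (orbit i)) v v≢b
    critical-in : ∃₂ (λ i j → i ℕ.< j × O i ≡ O j) → Σ (ZV n) λ c → Critical A b c × Coeval A b s c
    critical-in (i , j , i<j , Oi≡Oj) =
      O i , (orbit-config i , proj₂ (orbit i) , j ℕ.∸ i , ℕP.m<n⇒0<n∸m i<j , cycle) , i , orbit-prefix i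
      where
      cycle : SuccIter A b (j ℕ.∸ i) (O i) (O i)
      cycle = subst (SuccIter A b (j ℕ.∸ i) (O i)) (trans (cong O (ℕP.m∸n+n≡m (ℕP.<⇒≤ i<j))) (sym Oi≡Oj))
                    (orbit-segment i (j ℕ.∸ i))

  critical-loop : ∀ {c} → Critical A b c → Σ (Run c c) λ r → ∀ w → + 0 < fired r w
  critical-loop {c} (_ , _ , k , 0<k , cycle) = loop , λ w →
    kernel-positivity-spreads (fired loop) (fired-nonNeg loop) (loop-in-kernel loop) (sc b w)
      (subst (+ 0 <_) (sym (fired-fromSuccIter-bank cycle)) (ℤ.+<+ 0<k))
    where
    loop : Run c c
    loop = fromSuccIter cycle

  critical-nonNeg : ∀ {c} → Critical A b c → ∀ v → v ≢ b → + 0 ≤ lookup c v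
  critical-nonNeg cr v v≢b = fired⇒nonNeg (proj₁ (critical-loop cr)) v v≢b (proj₂ (critical-loop cr) v)

  critical-minimal : ∀ {c d} (x : Fin n → ℤ) → Critical A b c → Stable A b d →
    (∀ u → lookup d u ≡ lookup c u + Qᵀ x u) → (∀ u → + 0 ≤ x u) → x b ≡ + 0 → ∀ u → x u ≡ + 0
  critical-minimal {c} {d} x cr stable-d d≡c+Qᵀx 0≤x xb≡0 u = ℤP.≤-antisym x≤0 (0≤x u)
    where
    loop : Run c c
    loop = proj₁ (critical-loop cr)
    f : Fin n → ℤ
    f = fired loop
    M : ℕ
    M = ℤ.∣ ℓ¹ x ∣
    y : Fin n → ℤ
    y u = - x u + + M * f u
    x≤Mf : ∀ u → x u ≤ + M * f u
    x≤Mf u = ℤP.≤-trans (nonNeg≤ℓ¹ x u (0≤x u))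
      (subst (_≤ + M * f u) (ℤP.0≤i⇒+∣i∣≡i (ℓ¹-nonNeg x)) (i≤i*j (ℤ.+≤+ z≤n) (proj₂ (critical-loop cr) u)))
    0≤y : ∀ u → + 0 ≤ y u
    0≤y u = subst (_≤ y u) (ℤP.+-inverseˡ (x u)) (ℤP.+-monoʳ-≤ (- x u) (x≤Mf u))
    fired≤y-bank : fired (repeat M loop) b ≤ y b
    fired≤y-bank = ℤP.≤-reflexive (trans (fired-repeat M loop b)
      (sym (trans (cong (λ t → - t + + M * f b) xb≡0) (ℤP.+-identityˡ _))))
    c-Qᵀy≡d : ∀ u → lookup c u - Qᵀ y u ≡ lookup d u
    c-Qᵀy≡d u = begin
      lookup c u - Qᵀ y u
        ≡⟨ cong (_-_ (lookup c u)) (Qᵀ-kernel-multiple (λ u → - x u) f (loop-in-kernel loop) (+ M) u) ⟩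
      lookup c u - Qᵀ (λ u → - x u) u
        ≡⟨ cong (_-_ (lookup c u)) (Qᵀ-neg x u) ⟩
      lookup c u - - Qᵀ x u
        ≡⟨ cong (_+_ (lookup c u)) (ℤP.neg-involutive (Qᵀ x u)) ⟩
      lookup c u + Qᵀ x u
        ≡⟨ d≡c+Qᵀx u ⟨
      lookup d u ∎
      where open ≡-Reasoning
    stable-c-Qᵀy : StableFun (λ u → lookup c u - Qᵀ y u)
    stable-c-Qᵀy v v≢b = subst (_< deg v) (sym (c-Qᵀy≡d v)) (stable⇒StableFun {d} stable-d v v≢b)
    x≤0 : x u ≤ + 0
    x≤0 = i≤-j+i⇒j≤0 (subst (_≤ y u) (fired-repeat M loop u)
                         (leastAction (repeat M loop) y 0≤y fired≤y-bank stable-c-Qᵀy u))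

  stable-reaches-critical : ∀ {s c} → Stable A b s → Critical A b c → s ∼ c → Coeval A b s c
  stable-reaches-critical {s} {c} stable-s cr (∼-via z s-c≡Qᵀz) = j , subst (SuccIter A b j s) d≡c iter
    where
    loop : Run c c
    loop = proj₁ (critical-loop cr)
    preimage : Σ (Fin n → ℤ) λ y → (∀ u → + 0 ≤ y u) × (∀ w → Qᵀ y w ≡ Qᵀ z w)
    preimage = nonNeg-preimage (fired loop) (proj₂ (critical-loop cr)) (loop-in-kernel loop) z
    y : Fin n → ℤ
    y = proj₁ preimage
    0≤y : ∀ u → + 0 ≤ y u
    0≤y = proj₁ (proj₂ preimage)
    c≡s-Qᵀy : ∀ u → lookup c u ≡ lookup s u - Qᵀ y u
    c≡s-Qᵀy u = trans (sym (cancel (lookup s u) (lookup c u)))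
                      (cong (_-_ (lookup s u)) (trans (s-c≡Qᵀz u) (sym (proj₂ (proj₂ preimage) u))))
      where
      cancel : ∀ s c → s - (s - c) ≡ c
      cancel = solve-∀
    j : ℕ
    j = ℤ.∣ y b ∣
    d : ZV n
    d = proj₁ (iterate j s stable-s)
    iter : SuccIter A b j s d
    iter = proj₁ (proj₂ (iterate j s stable-s))
    x : Fin n → ℤ
    x = fired (fromSuccIter iter)
    xb≡yb : x b ≡ y b
    xb≡yb = trans (fired-fromSuccIter-bank iter) (ℤP.0≤i⇒+∣i∣≡i (0≤y b))
    x≤y : ∀ u → x u ≤ y u
    x≤y = leastAction (fromSuccIter iter) y 0≤y (ℤP.≤-reflexive xb≡yb)
            (λ v v≢b → subst (_< deg v) (c≡s-Qᵀy v) (stable⇒StableFun {c} (proj₁ (proj₂ cr)) v v≢b))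
    d≡c+Qᵀ[y-x] : ∀ u → lookup d u ≡ lookup c u + Qᵀ (λ u → y u - x u) u
    d≡c+Qᵀ[y-x] u = begin
      lookup d u                                    ≡⟨ run-result (fromSuccIter iter) u ⟩
      lookup s u - Qᵀ x u                           ≡⟨ regroup (lookup s u) (Qᵀ y u) (Qᵀ x u) ⟩
      (lookup s u - Qᵀ y u) + (Qᵀ y u - Qᵀ x u)     ≡⟨ cong₂ _+_ (c≡s-Qᵀy u) (Qᵀ-- y x u) ⟨
      lookup c u + Qᵀ (λ u → y u - x u) u           ∎
      where
      open ≡-Reasoning
      regroup : ∀ s p q → s - q ≡ (s - p) + (p - q)
      regroup = solve-∀
    d≡c : d ≡ c
    d≡c = vec-ext λ u → begin
      lookup d u                                ≡⟨ d≡c+Qᵀ[y-x] u ⟩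
      lookup c u + Qᵀ (λ u → y u - x u) u       ≡⟨ cong (_+_ (lookup c u)) (trans (Qᵀ-cong y-x≡0 u) (Qᵀ-zero u)) ⟩
      lookup c u + + 0                          ≡⟨ ℤP.+-identityʳ (lookup c u) ⟩
      lookup c u                                ∎
      where
      open ≡-Reasoning
      y-x≡0 : ∀ u → y u - x u ≡ + 0
      y-x≡0 = critical-minimal {c} {d} (λ u → y u - x u) cr (proj₂ (proj₂ (iterate j s stable-s)))
                d≡c+Qᵀ[y-x] (λ u → ℤP.i≤j⇒0≤j-i (x≤y u)) (trans (cong (_-_ (y b)) xb≡yb) (ℤP.+-inverseʳ (y b)))

  class⇒∼ : ∀ {u c} → InClassOf A b u c → u ∼ c
  class⇒∼ (_ , _ , (fs , _) , (_ , iter)) = run⇒∼ (fromFireSeq fs ++ fromSuccIter iter)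

  class-representative : ∀ u → IsConfig u → Σ (ZV n) (InClassOf A b u)
  class-representative u config = extend (stabilize u)
    where
    extend : Σ (ZV n) (Stabilizes A b u) → Σ (ZV n) (InClassOf A b u)
    extend (d , fs , stable-d) = c , cr , d , (fs , stable-d) , coeval
      where
      eventual : Σ (ZV n) λ c → Critical A b c × Coeval A b d c
      eventual = eventually-critical d stable-d (trans (sum-run (fromFireSeq fs)) config)
      c : ZV n
      c = proj₁ eventual
      cr : Critical A b c
      cr = proj₁ (proj₂ eventual)
      coeval : Coeval A b d c
      coeval = proj₂ (proj₂ eventual)

  class-invariant : ∀ {u u′} → u ∼ u′ → ∀ c → InClassOf A b u c → InClassOf A b u′ c
  class-invariant {u} {u′} u∼u′ c cl@(cr , _) = reach (stabilize u′)
    where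
    reach : Σ (ZV n) (Stabilizes A b u′) → InClassOf A b u′ c
    reach (d′ , fs′ , stable-d′) = cr , d′ , (fs′ , stable-d′) , stable-reaches-critical stable-d′ cr
      (∼-trans (∼-sym (run⇒∼ (fromFireSeq fs′))) (∼-trans (∼-sym u∼u′) (class⇒∼ cl)))

  same-class⇒∼ : ∀ {u u′} → IsConfig u → (∀ c → InClassOf A b u c ⇔ InClassOf A b u′ c) → u ∼ u′
  same-class⇒∼ {u} {u′} config same-class = through (class-representative u config)
    where
    through : Σ (ZV n) (InClassOf A b u) → u ∼ u′
    through (c , cl) = ∼-trans (class⇒∼ cl) (∼-sym (class⇒∼ (Equivalence.to (same-class c) cl)))

  stabilization-of-stable : ∀ {c d} → Stable A b c → FireSeq A b c d → d ≡ c
  stabilization-of-stable stable done                          = refl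
  stabilization-of-stable {c} stable (step v (v≢b , deg≤cv) _) =
    ⊥-elim (ℤP.<-irrefl refl (ℤP.<-≤-trans (stable⇒StableFun {c} stable v v≢b) deg≤cv))

  class-of-critical : ∀ {c} → Critical A b c → ∀ c′ → InClassOf A b c c′ ⇔ InCoevalClass A b c c′
  class-of-critical {c} (_ , stable , _) c′ = mk⇔
    (λ { (cr′ , d , (fs , _) , coeval) →
           cr′ , subst (λ e → Coeval A b e c′) (stabilization-of-stable stable fs) coeval })
    (λ { (cr′ , coeval) → cr′ , c , (done , stable) , coeval })

  config⇒torsion : ∀ u → IsConfig u → IsTorsion A u
  config⇒torsion u config = torsion (boxed-sequence-repeats (+ 0) (+ totalDeg) (+ 0) C C-config C-boxed)
    where
    rep : ∀ i → Σ (ZV n) (InClassOf A b (scale i u))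
    rep i = class-representative (scale i u)
              (trans (sum-scale i u) (trans (cong (+ i *_) config) (ℤP.*-zeroʳ (+ i))))
    C : ℕ → ZV n
    C i = proj₁ (rep i)
    C-config : ∀ i → IsConfig (C i)
    C-config i = proj₁ (proj₁ (proj₂ (rep i)))
    C-boxed : ∀ i → Boxed (+ 0) (+ totalDeg) (C i)
    C-boxed i v v≢b = critical-nonNeg (proj₁ (proj₂ (rep i))) v v≢b ,
                      stable⇒≤totalDeg {C i} (proj₁ (proj₂ (proj₁ (proj₂ (rep i))))) v v≢b
    torsion : ∃₂ (λ i j → i ℕ.< j × C i ≡ C j) → IsTorsion A u
    torsion (i , j , i<j , Ci≡Cj) = j ℕ.∸ i , ℕP.m<n⇒0<n∸m i<j , image-of z (λ w → begin
      lookup (scale (j ℕ.∸ i) u) w                       ≡⟨ lookup-scale (j ℕ.∸ i) u w ⟩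
      + (j ℕ.∸ i) * lookup u w                           ≡⟨ cong (_* lookup u w) j-i≡ ⟩
      (+ j - + i) * lookup u w                           ≡⟨ distribute (+ j) (+ i) (lookup u w) ⟩
      + j * lookup u w - + i * lookup u w                ≡⟨ cong₂ _-_ (lookup-scale j u w) (lookup-scale i u w) ⟨
      lookup (scale j u) w - lookup (scale i u) w        ≡⟨ difference w ⟩
      Qᵀ z w                                             ∎)
      where
      open ≡-Reasoning
      ju∼iu : scale j u ∼ scale i u
      ju∼iu = ∼-trans (class⇒∼ (proj₂ (rep j))) (subst (_∼ scale i u) Ci≡Cj (∼-sym (class⇒∼ (proj₂ (rep i)))))
      open _∼_ ju∼iu renaming (witness to z)
      distribute : ∀ j i x → (j - i) * x ≡ j * x - i * x
      distribute = solve-∀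
      j-i≡ : + (j ℕ.∸ i) ≡ + j - + i
      j-i≡ = trans (sym (ℤP.⊖-≥ (ℕP.<⇒≤ i<j))) (sym (ℤP.[+m]-[+n]≡m⊖n j i))

theorem9p8 : (n : ℕ) (A : Adj n) (bank : Fin n) →
    Loopless A → StronglyConnected A →
    ((u : ZV n) → IsTorsion A u ⇔ IsConfig u)
    × ((u u' : ZV n) → IsConfig u → IsConfig u' →
        InImageQT A (zipWith _-_ u u') →
        (c : ZV n) → InClassOf A bank u c ⇔ InClassOf A bank u' c)
    × ((u u' : ZV n) → IsConfig u → IsConfig u' →
        ((c : ZV n) → InClassOf A bank u c ⇔ InClassOf A bank u' c) →
        InImageQT A (zipWith _-_ u u'))
    × ((c : ZV n) → Critical A bank c →
        Σ (ZV n) λ u → IsConfig u ×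
          ((c' : ZV n) → InClassOf A bank u c' ⇔ InCoevalClass A bank c c'))
-- The argument works verbatim for graphs with loops.
theorem9p8 n A bank _ sc =
    (λ u → mk⇔ (torsion⇒config u) (config⇒torsion u))
  , (λ u u′ _ _ image c → mk⇔ (class-invariant (image⇒∼ image) c) (class-invariant (∼-sym (image⇒∼ image)) c))
  , (λ u u′ config _ same-class → ∼⇒image (same-class⇒∼ config same-class))
  , (λ c critical → c , proj₁ critical , class-of-critical critical)
  where open Dynamics A bank sc
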